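{- Let $\Lambda$ be an optimal hyperplane cover of a $d$-dimensional extremal $(0,1)$-matrix $A$ of order $n$ with deficiency $\delta$. If $\lambda_{i,j}\neq\lambda_{i,l}$ are two entries in the same row $i$ of $\Lambda$, then $|\lambda_{i,j}-\lambda_{i,l}|\ge\delta$.
   Context: A $d$-dimensional matrix of order $n$ is an array $(a_\alpha)_{\alpha\in\{1,\dots,n\}^d}$; $\mathrm{supp}(A)=\{\alpha:a_\alpha\ne0\}$; the hyperplane $\Gamma_{i,j}$ is the set of indices with $\alpha_i=j$. A polyplex of weight $W$ is a nonnegative matrix $K$ of order $n$ whose entries sum to at most $1$ over each hyperplane and to $W$ in total; a polydiagonal is a polyplex of weight $n$. A $(0,1)$-matrix $A$ contains $K$ if $\mathrm{supp}(K)\subseteq\mathrm{supp}(A)$. A hyperplane cover of $A$ is a nonnegative $d\times n$ table $\Lambda=(\lambda_{i,j})$ with $\sum_{i=1}^d\lambda_{i,\alpha_i}\ge1$ for all $\alpha\in\mathrm{supp}(A)$; its weight is the sum of its entries; it is optimal if it has minimum weight among hyperplane covers of $A$. A $(0,1)$-matrix $A$ is extremal if it contains no polydiagonal, but for every index $\alpha$ with $a_\alpha=0$ the matrix obtained by changing $a_\alpha$ to $1$ contains a polydiagonal. The deficiency of an extremal matrix of order $n$ is $n$ minus the maximum weight of a polyplex contained in it.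
   Formalization: The entries of Λ and of every polyplex and hyperplane cover occurring in the definitions, as well as the deficiency δ, are rational. -}

module Defs where

open import Data.Nat using (ℕ; zero; suc)
open import Data.Fin using (Fin)
import Data.Fin.Properties as FinP
open import Data.Bool using (Bool; true; false; if_then_else_; _∨_)
open import Data.List using (List; []; _∷_; map; concatMap; foldr; allFin)
open import Data.Vec using (Vec; lookup) renaming ([] to []ᵥ; _∷_ to _∷ᵥ_)
open import Data.Vec.Properties using (≡-dec)
open import Data.Rational using (ℚ; 0ℚ; 1ℚ; _+_; _-_; _≤_; _/_)
open import Data.Integer using (+_)
open import Data.Product using (_×_; Σ; ∃; ∃-syntax)
open import Relation.Nullary using (¬_; does)
open import Relation.Binary.PropositionalEquality using (_≡_; _≢_)

ℕtoℚ : ℕ → ℚ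
ℕtoℚ k = + k / 1

Index : ℕ → ℕ → Set
Index d n = Vec (Fin n) d

indices : (d n : ℕ) → List (Index d n)
indices zero n = []ᵥ ∷ []
indices (suc d) n = concatMap (λ j → map (λ α → j ∷ᵥ α) (indices d n)) (allFin n)

sumℚ : List ℚ → ℚ
sumℚ = foldr _+_ 0ℚ

-- real(=rational)-valued d-dimensional matrix of order n
Matrix : ℕ → ℕ → Set
Matrix d n = Index d n → ℚ

Matrix01 : ℕ → ℕ → Set
Matrix01 d n = Index d n → Bool

total : ∀ {d n} → Matrix d n → ℚ
total {d} {n} K = sumℚ (map K (indices d n))

hyperSum : ∀ {d n} → Matrix d n → Fin d → Fin n → ℚ
hyperSum {d} {n} K i j =
  sumℚ (map (λ α → if does (lookup α i FinP.≟ j) then K α else 0ℚ) (indices d n))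

Polyplex : ∀ {d n} → Matrix d n → ℚ → Set
Polyplex {d} {n} K W =
  (∀ α → 0ℚ ≤ K α) × (∀ i j → hyperSum K i j ≤ 1ℚ) × (total K ≡ W)

Polydiagonal : ∀ {d n} → Matrix d n → Set
Polydiagonal {d} {n} K = Polyplex K (ℕtoℚ n)

Contains : ∀ {d n} → Matrix01 d n → Matrix d n → Set
Contains A K = ∀ α → K α ≢ 0ℚ → A α ≡ true

ContainsPolydiagonal : ∀ {d n} → Matrix01 d n → Set
ContainsPolydiagonal {d} {n} A = ∃[ K ] (Polydiagonal K × Contains A K)

setOne : ∀ {d n} → Matrix01 d n → Index d n → Matrix01 d n
setOne A α β = A β ∨ does (≡-dec FinP._≟_ β α)

Extremal : ∀ {d n} → Matrix01 d n → Set
Extremal A =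
  (¬ ContainsPolydiagonal A) × (∀ α → A α ≡ false → ContainsPolydiagonal (setOne A α))

IsDeficiency : ∀ {d n} → Matrix01 d n → ℚ → Set
IsDeficiency {d} {n} A δ =
  (∃[ K ] (Polyplex K (ℕtoℚ n - δ) × Contains A K)) ×
  (∀ K W → Polyplex K W → Contains A K → W ≤ ℕtoℚ n - δ)

Table : ℕ → ℕ → Set
Table d n = Fin d → Fin n → ℚ

weight : ∀ {d n} → Table d n → ℚ
weight {d} {n} Λ = sumℚ (map (λ i → sumℚ (map (Λ i) (allFin n))) (allFin d))

HyperplaneCover : ∀ {d n} → Matrix01 d n → Table d n → Set
HyperplaneCover {d} {n} A Λ =
  (∀ i j → 0ℚ ≤ Λ i j) ×
  (∀ α → A α ≡ true → 1ℚ ≤ sumℚ (map (λ i → Λ i (lookup α i)) (allFin d)))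

OptimalCover : ∀ {d n} → Matrix01 d n → Table d n → Set
OptimalCover A Λ =
  HyperplaneCover A Λ × (∀ Λ' → HyperplaneCover A Λ' → weight Λ ≤ weight Λ')

{-# OPTIONS --safe #-}
-- Suppose λ_{i,l} < λ_{i,j} with gap ε = λ_{i,j} − λ_{i,l} < δ, and lower λ_{i,j} to λ_{i,l}.
-- The new table weighs ε less, so by optimality some β ∈ supp A with β_i = j is now covered
-- less than 1.  Its neighbour α (β with β_i replaced by l) is covered by Λ exactly as much, so
-- α ∉ supp A, and 1 − coverage(α) ≤ ε because β was covered by Λ.  By extremality, A with α
-- switched on contains a polydiagonal P.  Pairing P with Λ and using the strong duality
-- weight Λ ≤ n − δ (proved by Fourier–Motzkin elimination) gives
-- δ ≤ P_α (1 − coverage(α)) ≤ 1 − coverage(α) ≤ ε, a contradiction.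
module Submission where

open import Defs
import Data.Nat as ℕ
open import Data.Nat using (ℕ; zero; suc)
open import Data.Fin using (Fin; zero; suc; _↑ˡ_; _↑ʳ_; combine; remQuot)
open import Data.Fin.Properties using (_≟_; remQuot-combine)
open import Data.List.Membership.Propositional using (_∈_)
open import Data.List.Membership.Propositional.Properties using (∈-allFin; ∈-map⁺; ∈-concatMap⁺)
import Data.List.Relation.Unary.Any as Any
open import Data.Rational using (ℚ; 0ℚ; 1ℚ; _+_; _*_; _-_; -_; 1/_; _≤_; _<_; ∣_∣; positive; nonNegative)
open import Data.Rational.Properties renaming (_≟_ to _≟ℚ_)
open import Data.Rational.Solver using (module +-*-Solver)
open import Data.List using (List; []; _∷_; map; concatMap; allFin; _++_)
open import Data.List.Properties using (map-tabulate)
open import Data.List.Relation.Unary.All as All using (All; []; _∷_)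
import Data.List.Relation.Unary.All.Properties as All
open import Data.Vec using (lookup; _[_]≔_) renaming ([] to []ᵥ; _∷_ to _∷ᵥ_)
open import Data.Vec.Properties using (≡-dec; lookup∘update; lookup∘update′)
open import Data.Vec.Functional using (updateAt) renaming (_∷_ to _∷ᶠ_; tail to tailᶠ)
open import Data.Vec.Functional.Properties using (updateAt-updates; updateAt-minimal)
import Data.List.Extrema
open import Data.Bool using (Bool; true; false; if_then_else_; _∧_; _∨_)
open import Data.Bool.Properties using (∨-identityʳ)
open import Data.Product using (_×_; _,_; proj₁; proj₂; Σ; map₂; uncurry)
open import Data.Sum as Sum using (_⊎_; inj₁; inj₂; map₁)
open import Data.Empty using (⊥)
open import Relation.Nullary using (¬_; yes; no; does; contradiction)
open import Relation.Nullary.Decidable using (dec-true; dec-false; decidable-stable)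
open import Function using (_∘_)
open import Relation.Binary.PropositionalEquality
open import Relation.Binary.Definitions using (tri<; tri≈; tri>)
open import Relation.Binary.Bundles using (DecTotalOrder)
open +-*-Solver

private variable
  p q r : ℚ
  N : ℕ

p≤q⇒0≤q-p : p ≤ q → 0ℚ ≤ q - p
p≤q⇒0≤q-p {p} {q} p≤q = subst (_≤ q - p) (+-inverseʳ p) (+-monoˡ-≤ (- p) p≤q)

p<q⇒0<q-p : p < q → 0ℚ < q - p
p<q⇒0<q-p {p} {q} p<q = subst (_< q - p) (+-inverseʳ p) (+-monoˡ-< (- p) p<q)

0≤q-p⇒p≤q : 0ℚ ≤ q - p → p ≤ q
0≤q-p⇒p≤q {q} {p} 0≤q-p =
  subst₂ _≤_ (+-identityˡ p) (solve 2 (λ p q → (q :- p) :+ p := q) refl p q) (+-monoˡ-≤ p 0≤q-p)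

r≤q⇒0*p+r≤q : r ≤ q → 0ℚ * p + r ≤ q
r≤q⇒0*p+r≤q {r} {q} {p} = subst (_≤ q) (sym (trans (cong (_+ r) (*-zeroˡ p)) (+-identityˡ r)))

≤-byDifference : ∀ {e} → 0ℚ ≤ e → q - p ≡ e → p ≤ q
≤-byDifference 0≤e q-p≡e = 0≤q-p⇒p≤q (subst (0ℚ ≤_) (sym q-p≡e) 0≤e)

p≤q-r⇒1*p+r≤q : p ≤ q - r → 1ℚ * p + r ≤ q
p≤q-r⇒1*p+r≤q {p} {q} {r} p≤q-r = ≤-byDifference (p≤q⇒0≤q-p p≤q-r)
  (solve 3 (λ p q r → q :- (con 1ℚ :* p :+ r) := (q :- r) :- p) refl p q r)

r-q≤p⇒-1*p+r≤q : r - q ≤ p → - 1ℚ * p + r ≤ q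
r-q≤p⇒-1*p+r≤q {r} {q} {p} r-q≤p = ≤-byDifference (p≤q⇒0≤q-p r-q≤p)
  (solve 3 (λ p q r → q :- (:- con 1ℚ :* p :+ r) := p :- (r :- q)) refl p q r)

*-nonNeg : 0ℚ ≤ p → 0ℚ ≤ q → 0ℚ ≤ p * q
*-nonNeg {p} {q} 0≤p 0≤q = subst (_≤ p * q) (*-zeroʳ p) (*-monoˡ-≤-nonNeg p {{nonNegative 0≤p}} 0≤q)

combination-mono-≤ : ∀ {s t a a′ b b′} → 0ℚ ≤ s → 0ℚ ≤ t → a ≤ b → a′ ≤ b′ →
                     s * a + t * a′ ≤ s * b + t * b′
combination-mono-≤ {s} {t} 0≤s 0≤t a≤b a′≤b′ =
  +-mono-≤ (*-monoˡ-≤-nonNeg s {{nonNegative 0≤s}} a≤b) (*-monoˡ-≤-nonNeg t {{nonNegative 0≤t}} a′≤b′)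

1/pos : (q : ℚ) → 0ℚ < q → ℚ
1/pos q 0<q = (1/ q) {{pos⇒nonZero q {{positive 0<q}}}}

1/pos-inverseˡ : (q : ℚ) (0<q : 0ℚ < q) → 1/pos q 0<q * q ≡ 1ℚ
1/pos-inverseˡ q 0<q = *-inverseˡ q {{pos⇒nonZero q {{positive 0<q}}}}

1/pos-pos : (q : ℚ) (0<q : 0ℚ < q) → 0ℚ < 1/pos q 0<q
1/pos-pos q 0<q = positive⁻¹ _ {{1/pos⇒pos q {{positive 0<q}}}}

-- Finite sums

module _ {A B : Set} {Q : B → Set} (f : A → List B) where

  All-concatMap⁺ : ∀ {P : A → Set} {L} → (∀ x → P x → All Q (f x)) → All P L → All Q (concatMap f L)
  All-concatMap⁺ h = All.concat⁺ ∘ All.map⁺ ∘ All.map (h _)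

  All-concatMap⁻ : ∀ {L} → All Q (concatMap f L) → All (λ x → All Q (f x)) L
  All-concatMap⁻ = All.map⁻ ∘ All.concat⁻

module _ {A : Set} where

  sum-cong : (L : List A) {f g : A → ℚ} → (∀ x → f x ≡ g x) → sumℚ (map f L) ≡ sumℚ (map g L)
  sum-cong []      f≗g = refl
  sum-cong (x ∷ L) f≗g = cong₂ _+_ (f≗g x) (sum-cong L f≗g)

  sum-zero : (L : List A) → sumℚ (map (λ _ → 0ℚ) L) ≡ 0ℚ
  sum-zero []      = refl
  sum-zero (x ∷ L) = cong (0ℚ +_) (sum-zero L)

  sum-distrib-+ : (L : List A) (f g : A → ℚ) →
                  sumℚ (map (λ x → f x + g x) L) ≡ sumℚ (map f L) + sumℚ (map g L)
  sum-distrib-+ []      f g = refl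
  sum-distrib-+ (x ∷ L) f g rewrite sum-distrib-+ L f g =
    solve 4 (λ a b c d → (a :+ b) :+ (c :+ d) := (a :+ c) :+ (b :+ d)) refl
      (f x) (g x) (sumℚ (map f L)) (sumℚ (map g L))

  sum-distribˡ-* : (L : List A) (c : ℚ) (f : A → ℚ) →
                   sumℚ (map (λ x → c * f x) L) ≡ c * sumℚ (map f L)
  sum-distribˡ-* []      c f = sym (*-zeroʳ c)
  sum-distribˡ-* (x ∷ L) c f rewrite sum-distribˡ-* L c f = sym (*-distribˡ-+ c (f x) (sumℚ (map f L)))

  sum-mono-≤ : (L : List A) {f g : A → ℚ} → (∀ x → f x ≤ g x) → sumℚ (map f L) ≤ sumℚ (map g L)
  sum-mono-≤ []      f≤g = ≤-refl
  sum-mono-≤ (x ∷ L) f≤g = +-mono-≤ (f≤g x) (sum-mono-≤ L f≤g)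

  sum-nonNeg : (L : List A) {f : A → ℚ} → (∀ x → 0ℚ ≤ f x) → 0ℚ ≤ sumℚ (map f L)
  sum-nonNeg L {f} 0≤f = subst (_≤ sumℚ (map f L)) (sum-zero L) (sum-mono-≤ L 0≤f)

  sum-++ : (L M : List A) (f : A → ℚ) → sumℚ (map f (L ++ M)) ≡ sumℚ (map f L) + sumℚ (map f M)
  sum-++ []      M f = sym (+-identityˡ _)
  sum-++ (x ∷ L) M f rewrite sum-++ L M f = sym (+-assoc (f x) _ _)

module _ {A B : Set} where

  sum-map : (L : List A) (g : A → B) (f : B → ℚ) → sumℚ (map f (map g L)) ≡ sumℚ (map (λ x → f (g x)) L)
  sum-map []      g f = refl
  sum-map (x ∷ L) g f = cong (f (g x) +_) (sum-map L g f)

  sum-concatMap : (L : List A) (g : A → List B) (f : B → ℚ) →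
                  sumℚ (map f (concatMap g L)) ≡ sumℚ (map (λ x → sumℚ (map f (g x))) L)
  sum-concatMap []      g f = refl
  sum-concatMap (x ∷ L) g f =
    trans (sum-++ (g x) (concatMap g L) f) (cong (sumℚ (map f (g x)) +_) (sum-concatMap L g f))

  sum-comm : (L : List A) (M : List B) (f : A → B → ℚ) →
             sumℚ (map (λ x → sumℚ (map (f x) M)) L) ≡ sumℚ (map (λ y → sumℚ (map (λ x → f x y) L)) M)
  sum-comm []      M f = sym (sum-zero M)
  sum-comm (x ∷ L) M f rewrite sum-comm L M f = sym (sum-distrib-+ M (f x) (λ y → sumℚ (map (λ x → f x y) L)))

sumFin : (n : ℕ) → (Fin n → ℚ) → ℚ
sumFin n f = sumℚ (map f (allFin n))

sumFin-suc : (n : ℕ) (f : Fin (suc n) → ℚ) → sumFin (suc n) f ≡ f zero + sumFin n (f ∘ suc)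
sumFin-suc n f = cong (λ L → f zero + sumℚ L) (trans (map-tabulate suc f) (sym (map-tabulate (λ k → k) (f ∘ suc))))

sumFin-δ : (n : ℕ) (k : Fin n) (h : Fin n → ℚ) → sumFin n (λ j → if does (k ≟ j) then h j else 0ℚ) ≡ h k
sumFin-δ (suc n) zero h = begin
  sumFin (suc n) (λ j → if does (zero ≟ j) then h j else 0ℚ)
    ≡⟨ sumFin-suc n (λ j → if does (zero ≟ j) then h j else 0ℚ) ⟩
  h zero + sumFin n (λ _ → 0ℚ)
    ≡⟨ cong (h zero +_) (sum-zero (allFin n)) ⟩
  h zero + 0ℚ
    ≡⟨ +-identityʳ (h zero) ⟩
  h zero ∎
  where open ≡-Reasoning
sumFin-δ (suc n) (suc k) h = begin
  sumFin (suc n) (λ j → if does (suc k ≟ j) then h j else 0ℚ)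
    ≡⟨ sumFin-suc n (λ j → if does (suc k ≟ j) then h j else 0ℚ) ⟩
  0ℚ + sumFin n (λ j → if does (k ≟ j) then h (suc j) else 0ℚ)
    ≡⟨ +-identityˡ _ ⟩
  sumFin n (λ j → if does (k ≟ j) then h (suc j) else 0ℚ)
    ≡⟨ sumFin-δ n k (h ∘ suc) ⟩
  h (suc k) ∎
  where open ≡-Reasoning

sumFin-except : (n : ℕ) (i : Fin n) {f g : Fin n → ℚ} {e : ℚ} →
                f i ≡ g i + e → (∀ k → k ≢ i → f k ≡ g k) → sumFin n f ≡ sumFin n g + e
sumFin-except n i {f} {g} {e} fi≡gi+e f≗g = begin
  sumFin n f                                                   ≡⟨ sum-cong (allFin n) split ⟩
  sumFin n (λ k → g k + (if does (i ≟ k) then e else 0ℚ))      ≡⟨ sum-distrib-+ (allFin n) g _ ⟩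
  sumFin n g + sumFin n (λ k → if does (i ≟ k) then e else 0ℚ) ≡⟨ cong (sumFin n g +_) (sumFin-δ n i (λ _ → e)) ⟩
  sumFin n g + e                                               ∎
  where
  open ≡-Reasoning
  split : ∀ k → f k ≡ g k + (if does (i ≟ k) then e else 0ℚ)
  split k with i ≟ k
  ... | yes refl = fi≡gi+e
  ... | no i≢k   = trans (f≗g k (i≢k ∘ sym)) (sym (+-identityʳ (g k)))

sumFin-++ : (m k : ℕ) (f : Fin (m ℕ.+ k) → ℚ) →
            sumFin (m ℕ.+ k) f ≡ sumFin m (λ j → f (j ↑ˡ k)) + sumFin k (λ j → f (m ↑ʳ j))
sumFin-++ zero    k f = sym (+-identityˡ _)
sumFin-++ (suc m) k f = begin
  sumFin (suc m ℕ.+ k) f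
    ≡⟨ sumFin-suc (m ℕ.+ k) f ⟩
  f zero + sumFin (m ℕ.+ k) (f ∘ suc)
    ≡⟨ cong (f zero +_) (sumFin-++ m k (f ∘ suc)) ⟩
  f zero + (sumFin m (λ j → f (suc (j ↑ˡ k))) + right)
    ≡⟨ +-assoc (f zero) _ right ⟨
  (f zero + sumFin m (λ j → f (suc (j ↑ˡ k)))) + right
    ≡⟨ cong (_+ right) (sumFin-suc m (λ j → f (j ↑ˡ k))) ⟨
  sumFin (suc m) (λ j → f (j ↑ˡ k)) + right ∎
  where
  open ≡-Reasoning
  right : ℚ
  right = sumFin k (λ j → f (suc m ↑ʳ j))

sumFin-combine : (d n : ℕ) (f : Fin (d ℕ.* n) → ℚ) →
                 sumFin (d ℕ.* n) f ≡ sumFin d (λ i → sumFin n (λ j → f (combine i j)))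
sumFin-combine zero    n f = refl
sumFin-combine (suc d) n f = begin
  sumFin (suc d ℕ.* n) f
    ≡⟨ sumFin-++ n (d ℕ.* n) f ⟩
  first + sumFin (d ℕ.* n) (λ k → f (n ↑ʳ k))
    ≡⟨ cong (first +_) (sumFin-combine d n (λ k → f (n ↑ʳ k))) ⟩
  first + sumFin d (λ i → sumFin n (λ j → f (combine (suc i) j)))
    ≡⟨ sumFin-suc d (λ i → sumFin n (λ j → f (combine i j))) ⟨
  sumFin (suc d) (λ i → sumFin n (λ j → f (combine i j))) ∎
  where
  open ≡-Reasoning
  first : ℚ
  first = sumFin n (λ j → f (j ↑ˡ d ℕ.* n))

∈-indices : ∀ {d n} (β : Index d n) → β ∈ indices d n
∈-indices []ᵥ      = Any.here refl
∈-indices (b ∷ᵥ β) =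
  ∈-concatMap⁺ _ (Any.map (λ { refl → ∈-map⁺ (_ ∷ᵥ_) (∈-indices β) }) (∈-allFin b))

sum-indices-δ : (d n : ℕ) (β : Index d n) (g : Index d n → ℚ) →
                sumℚ (map (λ α → if does (≡-dec _≟_ β α) then g α else 0ℚ) (indices d n)) ≡ g β
sum-indices-δ zero    n []ᵥ      g = +-identityʳ (g []ᵥ)
sum-indices-δ (suc d) n (b ∷ᵥ β) g = begin
  sumℚ (map G (concatMap (λ j → map (j ∷ᵥ_) (indices d n)) (allFin n)))
    ≡⟨ sum-concatMap (allFin n) _ G ⟩
  sumFin n (λ j → sumℚ (map G (map (j ∷ᵥ_) (indices d n))))
    ≡⟨ sum-cong (allFin n) row ⟩
  sumFin n (λ j → if does (b ≟ j) then g (j ∷ᵥ β) else 0ℚ)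
    ≡⟨ sumFin-δ n b (λ j → g (j ∷ᵥ β)) ⟩
  g (b ∷ᵥ β) ∎
  where
  open ≡-Reasoning
  G : Index (suc d) n → ℚ
  G α = if does (≡-dec _≟_ (b ∷ᵥ β) α) then g α else 0ℚ
  -- does (≡-dec _≟_ (b ∷ β) (j ∷ α)) computes to does (b ≟ j) ∧ does (≡-dec _≟_ β α)
  row′ : ∀ j → (b≟j : Bool) →
         sumℚ (map (λ α → if b≟j ∧ does (≡-dec _≟_ β α) then g (j ∷ᵥ α) else 0ℚ) (indices d n)) ≡
         (if b≟j then g (j ∷ᵥ β) else 0ℚ)
  row′ j true  = sum-indices-δ d n β (g ∘ (j ∷ᵥ_))
  row′ j false = sum-zero (indices d n)
  row : ∀ j → sumℚ (map G (map (j ∷ᵥ_) (indices d n))) ≡ (if does (b ≟ j) then g (j ∷ᵥ β) else 0ℚ)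
  row j = trans (sum-map (indices d n) (j ∷ᵥ_) G) (row′ j (does (b ≟ j)))

term≤sum-indices : (d n : ℕ) (α : Index d n) (f : Index d n → ℚ) →
                   (∀ β → β ≢ α → 0ℚ ≤ f β) → f α ≤ sumℚ (map f (indices d n))
term≤sum-indices d n α f 0≤f =
  subst₂ _≤_ (+-identityˡ (f α)) (sym split) (+-monoˡ-≤ (f α) (sum-nonNeg L 0≤rest))
  where
  L : List (Index d n)
  L = indices d n
  rest : Index d n → ℚ
  rest β = if does (≡-dec _≟_ α β) then 0ℚ else f β
  0≤rest : ∀ β → 0ℚ ≤ rest β
  0≤rest β with ≡-dec _≟_ α β
  ... | yes _  = ≤-refl
  ... | no α≢β = 0≤f β (α≢β ∘ sym)
  split : sumℚ (map f L) ≡ sumℚ (map rest L) + f α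
  split = trans (sum-cong L pointwise)
                (trans (sum-distrib-+ L rest _) (cong (sumℚ (map rest L) +_) (sum-indices-δ d n α f)))
    where
    pointwise : ∀ β → f β ≡ rest β + (if does (≡-dec _≟_ α β) then f β else 0ℚ)
    pointwise β with ≡-dec _≟_ α β
    ... | yes _ = sym (+-identityˡ (f β))
    ... | no _  = sym (+-identityʳ (f β))

-- Fourier–Motzkin elimination

module Extrema = Data.List.Extrema (DecTotalOrder.totalOrder ≤-decTotalOrder)

between : (L U : List ℚ) → All (λ u → All (_≤ u) L) U → Σ ℚ λ x → All (_≤ x) L × All (x ≤_) U
between L U L≤U =
  max (min 0ℚ U) L , xs≤max (min 0ℚ U) L , All.zipWith (λ (m≤u , L≤u) → max≤v⁺ m≤u L≤u) (min≤xs 0ℚ U , L≤U)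
  where open Extrema

record Constraint (N : ℕ) : Set where
  constructor constraint
  field
    coeffs : Fin N → ℚ
    bound  : ℚ
open Constraint

infix  4 _≈ᶜ_
infixl 6 _⊕_
infixl 7 _⊛_ _·_

_·_ : (Fin N → ℚ) → (Fin N → ℚ) → ℚ
_·_ {N} a x = sumFin N (λ k → a k * x k)

Satisfies : (Fin N → ℚ) → Constraint N → Set
Satisfies x c = coeffs c · x ≤ bound c

_⊕_ : Constraint N → Constraint N → Constraint N
c ⊕ c′ = constraint (λ k → coeffs c k + coeffs c′ k) (bound c + bound c′)

_⊛_ : ℚ → Constraint N → Constraint N
r ⊛ c = constraint (λ k → r * coeffs c k) (r * bound c)

_≈ᶜ_ : Constraint N → Constraint N → Set
c ≈ᶜ c′ = (∀ k → coeffs c k ≡ coeffs c′ k) × bound c ≡ bound c′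

withHead : ℚ → Constraint N → Constraint (suc N)
withHead v c = constraint (v ∷ᶠ coeffs c) (bound c)

dropHead : Constraint (suc N) → Constraint N
dropHead c = constraint (tailᶠ (coeffs c)) (bound c)

Solvable : List (Constraint N) → Set
Solvable {N} S = Σ (Fin N → ℚ) λ x → All (Satisfies x) S

-- Coefficient vectors are functions, so closure of D under pointwise equality must be assumed.
module _ (D : Constraint N → Set) where

  Extensional : Set
  Extensional = ∀ {c c′} → c ≈ᶜ c′ → D c → D c′

  ConicallyClosed : Set
  ConicallyClosed = ∀ {c c′} s t → 0ℚ ≤ s → 0ℚ ≤ t → D c → D c′ → D (s ⊛ c ⊕ t ⊛ c′)

  Refutation : Set
  Refutation = Σ (Constraint N) λ c → D c × (∀ k → coeffs c k ≡ 0ℚ) × bound c < 0ℚ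

satisfies-≈ : ∀ {x : Fin N → ℚ} {c c′} → c ≈ᶜ c′ → Satisfies x c → Satisfies x c′
satisfies-≈ {N} {x} (a≗a′ , b≡b′) = subst₂ _≤_ (sum-cong (allFin N) (λ k → cong (_* x k) (a≗a′ k))) b≡b′

satisfies-⊛⁻ : ∀ {x : Fin N → ℚ} {c} → 0ℚ < r → Satisfies x (r ⊛ c) → Satisfies x c
satisfies-⊛⁻ {N} {r} {x} {c} 0<r sat =
  *-cancelˡ-≤-pos r {{positive 0<r}} (subst (_≤ r * bound c) r·ax≡r*a·x sat)
  where
  r·ax≡r*a·x : (λ k → r * coeffs c k) · x ≡ r * (coeffs c · x)
  r·ax≡r*a·x = trans (sum-cong (allFin N) (λ k → *-assoc r (coeffs c k) (x k))) (sum-distribˡ-* (allFin N) r _)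

·-distribʳ-+ : (a a′ x : Fin N → ℚ) → (λ k → a k + a′ k) · x ≡ a · x + a′ · x
·-distribʳ-+ {N} a a′ x =
  trans (sum-cong (allFin N) (λ k → *-distribʳ-+ (x k) (a k) (a′ k))) (sum-distrib-+ (allFin N) _ _)

satisfies-withHead : ∀ {x : Fin N → ℚ} {c} v x₀ → v * x₀ + coeffs c · x ≤ bound c →
                     Satisfies (x₀ ∷ᶠ x) (withHead v c)
satisfies-withHead {N} {x} {c} v x₀ =
  subst (_≤ bound c) (sym (sumFin-suc N (λ k → (v ∷ᶠ coeffs c) k * (x₀ ∷ᶠ x) k)))

satisfies-rescaled : ∀ {x : Fin N → ℚ} {c v} x₀ → 0ℚ < r → r * coeffs c zero ≡ v →
                     v * x₀ + coeffs (dropHead (r ⊛ c)) · x ≤ r * bound c → Satisfies (x₀ ∷ᶠ x) c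
satisfies-rescaled {r = r} {x} {c} {v} x₀ 0<r r*a≡v sat = satisfies-⊛⁻ {c = c} 0<r
  (satisfies-≈ {x = x₀ ∷ᶠ x} {withHead v (dropHead (r ⊛ c))} {r ⊛ c}
    ((λ { zero → sym r*a≡v ; (suc k) → refl }) , refl)
    (satisfies-withHead {x = x} {dropHead (r ⊛ c)} v x₀ sat))

data HeadSign (c : Constraint (suc N)) : Set where
  zero-head : coeffs c zero ≡ 0ℚ → HeadSign c
  pos-head  : (r : ℚ) → 0ℚ < r → r * coeffs c zero ≡ 1ℚ → HeadSign c
  neg-head  : (r : ℚ) → 0ℚ < r → r * coeffs c zero ≡ - 1ℚ → HeadSign c

headSign : (c : Constraint (suc N)) → HeadSign c
headSign c with <-cmp 0ℚ (coeffs c zero)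
... | tri< 0<a _ _ = pos-head (1/pos _ 0<a) (1/pos-pos _ 0<a) (1/pos-inverseˡ _ 0<a)
... | tri≈ _ 0≡a _ = zero-head (sym 0≡a)
... | tri> _ _ a<0 = neg-head s (1/pos-pos (- a) 0<-a) s*a≡-1
  where
  a : ℚ
  a = coeffs c zero
  0<-a : 0ℚ < - a
  0<-a = neg-antimono-< a<0
  s : ℚ
  s = 1/pos (- a) 0<-a
  s*a≡-1 : s * a ≡ - 1ℚ
  s*a≡-1 = trans (solve 2 (λ s a → s :* a := :- (s :* (:- a))) refl s a) (cong -_ (1/pos-inverseˡ (- a) 0<-a))

-- After rescaling, a leading coefficient 1 bounds the first variable from above and −1 from below;
-- elimination keeps the constraints without it and adds every sum of an upper and a lower one.
zeroPart upperPart lowerPart : (c : Constraint (suc N)) → HeadSign c → List (Constraint N)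
zeroPart c (zero-head _) = dropHead c ∷ []
zeroPart c _             = []
upperPart c (pos-head r _ _) = dropHead (r ⊛ c) ∷ []
upperPart c _                = []
lowerPart c (neg-head r _ _) = dropHead (r ⊛ c) ∷ []
lowerPart c _                = []

module Elimination (S : List (Constraint (suc N))) where

  zeros uppers lowers : List (Constraint N)
  zeros  = concatMap (λ c → zeroPart c (headSign c)) S
  uppers = concatMap (λ c → upperPart c (headSign c)) S
  lowers = concatMap (λ c → lowerPart c (headSign c)) S

  pairs : List (Constraint N)
  pairs = concatMap (λ u → map (u ⊕_) lowers) uppers

  eliminated : List (Constraint N)
  eliminated = zeros ++ pairs

  module _ {D : Constraint (suc N) → Set} (ext : Extensional D) (closed : ConicallyClosed D) where

    ⊛-closed : ∀ {c} → 0ℚ ≤ r → D c → D (r ⊛ c)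
    ⊛-closed {r} {c} 0≤r Dc =
      ext (drop-zero-multiple ∘ coeffs c , drop-zero-multiple (bound c)) (closed r 0ℚ 0≤r ≤-refl Dc Dc)
      where
      drop-zero-multiple : ∀ p → r * p + 0ℚ * p ≡ r * p
      drop-zero-multiple p = solve 2 (λ r p → r :* p :+ con 0ℚ :* p := r :* p) refl r p

    zeroPart-closed : ∀ c s → D c → All (D ∘ withHead 0ℚ) (zeroPart c s)
    zeroPart-closed c (zero-head a≡0)  Dc = ext ((λ { zero → a≡0 ; (suc k) → refl }) , refl) Dc ∷ []
    zeroPart-closed c (pos-head _ _ _) _ = []
    zeroPart-closed c (neg-head _ _ _) _ = []

    upperPart-closed : ∀ c s → D c → All (D ∘ withHead 1ℚ) (upperPart c s)
    upperPart-closed c (pos-head r 0<r r*a≡1) Dc =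
      ext ((λ { zero → r*a≡1 ; (suc k) → refl }) , refl) (⊛-closed (<⇒≤ 0<r) Dc) ∷ []
    upperPart-closed c (zero-head _)    _  = []
    upperPart-closed c (neg-head _ _ _) _ = []

    lowerPart-closed : ∀ c s → D c → All (D ∘ withHead (- 1ℚ)) (lowerPart c s)
    lowerPart-closed c (neg-head r 0<r r*a≡-1) Dc =
      ext ((λ { zero → r*a≡-1 ; (suc k) → refl }) , refl) (⊛-closed (<⇒≤ 0<r) Dc) ∷ []
    lowerPart-closed c (zero-head _)    _  = []
    lowerPart-closed c (pos-head _ _ _) _ = []

    pair-closed : ∀ {u l} → D (withHead 1ℚ u) → D (withHead (- 1ℚ) l) → D (withHead 0ℚ (u ⊕ l))
    pair-closed {u} {l} Du Dl =
      ext ((λ { zero → refl ; (suc k) → 1*p+1*q≡p+q (coeffs u k) (coeffs l k) }) , 1*p+1*q≡p+q (bound u) (bound l))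
          (closed 1ℚ 1ℚ (nonNegative⁻¹ 1ℚ) (nonNegative⁻¹ 1ℚ) Du Dl)
      where
      1*p+1*q≡p+q : ∀ p q → 1ℚ * p + 1ℚ * q ≡ p + q
      1*p+1*q≡p+q p q = cong₂ _+_ (*-identityˡ p) (*-identityˡ q)

    eliminated-closed : All D S → All (D ∘ withHead 0ℚ) eliminated
    eliminated-closed DS = All.++⁺
      (All-concatMap⁺ _ (λ c → zeroPart-closed c (headSign c)) DS)
      (All-concatMap⁺ _ (λ u Du → All.map⁺ (All.map (pair-closed Du) Dlowers)) Duppers)
      where
      Duppers : All (D ∘ withHead 1ℚ) uppers
      Duppers = All-concatMap⁺ _ (λ c → upperPart-closed c (headSign c)) DS
      Dlowers : All (D ∘ withHead (- 1ℚ)) lowers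
      Dlowers = All-concatMap⁺ _ (λ c → lowerPart-closed c (headSign c)) DS

  module _ (x : Fin N → ℚ) where

    upperBound lowerBound : Constraint N → ℚ
    upperBound u = bound u - coeffs u · x
    lowerBound l = coeffs l · x - bound l

    lowerBound≤upperBound : ∀ u l → Satisfies x (u ⊕ l) → lowerBound l ≤ upperBound u
    lowerBound≤upperBound u l sat = ≤-byDifference (p≤q⇒0≤q-p sat) (begin
      (bound u - U) - (L - bound l)
        ≡⟨ solve 4 (λ bu U L bl → (bu :- U) :- (L :- bl) := (bu :+ bl) :- (U :+ L)) refl (bound u) U L (bound l) ⟩
      (bound u + bound l) - (U + L)
        ≡⟨ cong (λ z → (bound u + bound l) - z) (·-distribʳ-+ (coeffs u) (coeffs l) x) ⟨
      bound (u ⊕ l) - coeffs (u ⊕ l) · x ∎)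
      where
      open ≡-Reasoning
      U L : ℚ
      U = coeffs u · x
      L = coeffs l · x

    satisfies-lift : ∀ x₀ c s → All (Satisfies x) (zeroPart c s) → All (λ u → x₀ ≤ upperBound u) (upperPart c s) →
                     All (λ l → lowerBound l ≤ x₀) (lowerPart c s) → Satisfies (x₀ ∷ᶠ x) c
    satisfies-lift x₀ c (zero-head a≡0) (sat ∷ []) _ _ =
      satisfies-≈ {x = x₀ ∷ᶠ x} {withHead 0ℚ (dropHead c)} {c} ((λ { zero → sym a≡0 ; (suc k) → refl }) , refl)
        (satisfies-withHead {x = x} {dropHead c} 0ℚ x₀ (r≤q⇒0*p+r≤q {p = x₀} sat))
    satisfies-lift x₀ c (pos-head r 0<r r*a≡1) _ (x₀≤ub ∷ []) _ =
      satisfies-rescaled {x = x} {c} x₀ 0<r r*a≡1 (p≤q-r⇒1*p+r≤q x₀≤ub)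
    satisfies-lift x₀ c (neg-head r 0<r r*a≡-1) _ _ (lb≤x₀ ∷ []) =
      satisfies-rescaled {x = x} {c} x₀ 0<r r*a≡-1 (r-q≤p⇒-1*p+r≤q lb≤x₀)

    lift-solution : All (Satisfies x) eliminated → Solvable S
    lift-solution sat = x₀ ∷ᶠ x , All.zipWith (λ { {c} (z , u , l) → satisfies-lift x₀ c (headSign c) z u l })
      ( All-concatMap⁻ (λ c → zeroPart c (headSign c)) (All.++⁻ˡ zeros sat)
      , All.zip ( All-concatMap⁻ (λ c → upperPart c (headSign c)) x₀≤uppers
                , All-concatMap⁻ (λ c → lowerPart c (headSign c)) lowers≤x₀))
      where
      satPairs : All (λ u → All (λ l → Satisfies x (u ⊕ l)) lowers) uppers
      satPairs = All.map All.map⁻ (All-concatMap⁻ (λ u → map (u ⊕_) lowers) (All.++⁻ʳ zeros sat))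
      choice : Σ ℚ λ x₀ → All (_≤ x₀) (map lowerBound lowers) × All (x₀ ≤_) (map upperBound uppers)
      choice = between (map lowerBound lowers) (map upperBound uppers)
                       (All.map⁺ (All.map (λ {u} → All.map⁺ ∘ All.map (lowerBound≤upperBound u _)) satPairs))
      x₀ : ℚ
      x₀ = proj₁ choice
      lowers≤x₀ : All (λ l → lowerBound l ≤ x₀) lowers
      lowers≤x₀ = All.map⁻ (proj₁ (proj₂ choice))
      x₀≤uppers : All (λ u → x₀ ≤ upperBound u) uppers
      x₀≤uppers = All.map⁻ (proj₂ (proj₂ choice))

solve-or-refute₀ : {D : Constraint 0 → Set} (S : List (Constraint 0)) → All D S → Solvable S ⊎ Refutation D
solve-or-refute₀ []      []        = inj₁ ((λ ()) , [])
solve-or-refute₀ (c ∷ S) (Dc ∷ DS) with 0ℚ ≤? bound c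
... | yes 0≤b = map₁ (map₂ (0≤b ∷_)) (solve-or-refute₀ S DS)
... | no  0≰b = inj₂ (c , Dc , (λ ()) , ≰⇒> 0≰b)

-- Farkas' lemma: with D the conic hull of S, a refutation is a nonnegative combination of S of the form 0 ≤ b < 0.
fourier-motzkin : ∀ N {D : Constraint N → Set} → Extensional D → ConicallyClosed D →
                  (S : List (Constraint N)) → All D S → Solvable S ⊎ Refutation D
fourier-motzkin zero    ext closed S DS = solve-or-refute₀ S DS
fourier-motzkin (suc N) {D} ext closed S DS =
  Sum.map (uncurry (lift-solution S)) padRefutation
    (fourier-motzkin N ext₀ closed₀ (eliminated S) (eliminated-closed S ext closed DS))
  where
  open Elimination
  ext₀ : Extensional (D ∘ withHead 0ℚ)
  ext₀ (a≗a′ , b≡b′) = ext ((λ { zero → refl ; (suc k) → a≗a′ k }) , b≡b′)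
  closed₀ : ConicallyClosed (D ∘ withHead 0ℚ)
  closed₀ s t 0≤s 0≤t Dc Dc′ =
    ext ((λ { zero → cong₂ _+_ (*-zeroʳ s) (*-zeroʳ t) ; (suc k) → refl }) , refl) (closed s t 0≤s 0≤t Dc Dc′)
  padRefutation : Refutation (D ∘ withHead 0ℚ) → Refutation D
  padRefutation (c , Dc , c≗0 , b<0) = withHead 0ℚ c , Dc , (λ { zero → refl ; (suc k) → c≗0 k }) , b<0

-- Strong duality for hyperplane covers

if-*ˡ : ∀ (b : Bool) p q → (if b then p else 0ℚ) * q ≡ (if b then p * q else 0ℚ)
if-*ˡ true  p q = refl
if-*ˡ false p q = *-zeroˡ q

coverage : ∀ {d n} → Table d n → Index d n → ℚ
coverage {d} Λ β = sumℚ (map (λ i → Λ i (lookup β i)) (allFin d))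

module _ {d n : ℕ} where

  toTable : (Fin (d ℕ.* n) → ℚ) → Table d n
  toTable x i j = x (combine i j)

  fromTable : Table d n → Fin (d ℕ.* n) → ℚ
  fromTable T k = uncurry T (remQuot n k)

  fromTable-combine : (T : Table d n) (i : Fin d) (j : Fin n) → fromTable T (combine i j) ≡ T i j
  fromTable-combine T i j = cong (uncurry T) (remQuot-combine i j)

  fromTable-· : (T : Table d n) (x : Fin (d ℕ.* n) → ℚ) →
                fromTable T · x ≡ sumFin d (λ i → sumFin n (λ j → T i j * toTable x i j))
  fromTable-· T x = trans (sumFin-combine d n _)
    (sum-cong (allFin d) λ i → sum-cong (allFin n) λ j → cong (_* toTable x i j) (fromTable-combine T i j))

  module _ (y y′ : Matrix d n) (s t : ℚ) where

    hyperSum-linear : ∀ i j → hyperSum (λ β → s * y β + t * y′ β) i j ≡ s * hyperSum y i j + t * hyperSum y′ i j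
    hyperSum-linear i j = trans (sum-cong (indices d n) (λ α → if-linear (does (lookup α i ≟ j)) (y α) (y′ α)))
      (trans (sum-distrib-+ (indices d n) _ _)
             (cong₂ _+_ (sum-distribˡ-* (indices d n) s _) (sum-distribˡ-* (indices d n) t _)))
      where
      if-linear : ∀ (b : Bool) p q →
                  (if b then s * p + t * q else 0ℚ) ≡ s * (if b then p else 0ℚ) + t * (if b then q else 0ℚ)
      if-linear true  p q = refl
      if-linear false p q = sym (cong₂ _+_ (*-zeroʳ s) (*-zeroʳ t))

    total-linear : total (λ β → s * y β + t * y′ β) ≡ s * total y + t * total y′
    total-linear = trans (sum-distrib-+ (indices d n) _ _)
      (cong₂ _+_ (sum-distribˡ-* (indices d n) s y) (sum-distribˡ-* (indices d n) t y′))

    Contains-linear : ∀ {A} → Contains A y → Contains A y′ → Contains A (λ β → s * y β + t * y′ β)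
    Contains-linear A⊇y A⊇y′ β ≢0 with y β ≟ℚ 0ℚ | y′ β ≟ℚ 0ℚ
    ... | no  yβ≢0 | _         = A⊇y β yβ≢0
    ... | yes _    | no y′β≢0 = A⊇y′ β y′β≢0
    ... | yes yβ≡0 | yes y′β≡0 = contradiction
      (trans (cong₂ (λ p q → s * p + t * q) yβ≡0 y′β≡0) (cong₂ _+_ (*-zeroʳ s) (*-zeroʳ t))) ≢0

  hyperSum-zero : ∀ i j → hyperSum {d} {n} (λ _ → 0ℚ) i j ≡ 0ℚ
  hyperSum-zero i j = trans (sum-cong (indices d n) (λ α → if-zero (does (lookup α i ≟ j)))) (sum-zero (indices d n))
    where
    if-zero : ∀ b → (if b then 0ℚ else 0ℚ) ≡ 0ℚ
    if-zero true  = refl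
    if-zero false = refl

  total-zero : total {d} {n} (λ _ → 0ℚ) ≡ 0ℚ
  total-zero = sum-zero (indices d n)

  unit : Index d n → Matrix d n
  unit β α = if does (≡-dec _≟_ β α) then 1ℚ else 0ℚ

  hyperSum-unit : ∀ β i j → hyperSum (unit β) i j ≡ (if does (lookup β i ≟ j) then 1ℚ else 0ℚ)
  hyperSum-unit β i j = trans (sum-cong (indices d n) (λ α → if-swap (does (lookup α i ≟ j)) (does (≡-dec _≟_ β α))))
    (sum-indices-δ d n β (λ α → if does (lookup α i ≟ j) then 1ℚ else 0ℚ))
    where
    if-swap : ∀ b b′ → (if b then (if b′ then 1ℚ else 0ℚ) else 0ℚ) ≡ (if b′ then (if b then 1ℚ else 0ℚ) else 0ℚ)
    if-swap true  b′    = refl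
    if-swap false true  = refl
    if-swap false false = refl

  total-unit : ∀ β → total (unit β) ≡ 1ℚ
  total-unit β = sum-indices-δ d n β (λ _ → 1ℚ)

module _ {d n : ℕ} {A : Matrix01 d n} {δ : ℚ} (deficiency : IsDeficiency A δ) where

  private
    w : ℚ
    w = ℕtoℚ n - δ

  total≤scaled-maxWeight : (y : Matrix d n) (t : ℚ) → (∀ β → 0ℚ ≤ y β) → Contains A y → 0ℚ ≤ t →
                           (∀ i j → hyperSum y i j ≤ t) → total y ≤ t * (ℕtoℚ n - δ)
  -- with K₀ a maximum-weight polyplex in A, (K₀ + y) / (1 + t) is a polyplex in A, so (w + total y) / (1 + t) ≤ w
  total≤scaled-maxWeight y t 0≤y A⊇y 0≤t hyperSum≤t =
    ≤-byDifference
      (p≤q⇒0≤q-p (subst (_≤ 1+t * w) [1+t]*total≡w+T (*-monoˡ-≤-nonNeg 1+t {{nonNegative (<⇒≤ 0<1+t)}} total≤w)))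
      (solve 3 (λ t w T → t :* w :- T := (con 1ℚ :+ t) :* w :- (w :+ T)) refl t w (total y))
    where
    K₀ : Matrix d n
    K₀ = proj₁ (proj₁ deficiency)
    K₀-polyplex : Polyplex K₀ w
    K₀-polyplex = proj₁ (proj₂ (proj₁ deficiency))
    1+t : ℚ
    1+t = 1ℚ + t
    0<1+t : 0ℚ < 1+t
    0<1+t = <-≤-trans (positive⁻¹ 1ℚ) (subst (_≤ 1+t) (+-identityʳ 1ℚ) (+-monoʳ-≤ 1ℚ 0≤t))
    s : ℚ
    s = 1/pos 1+t 0<1+t
    0≤s : 0ℚ ≤ s
    0≤s = <⇒≤ (1/pos-pos 1+t 0<1+t)
    K : Matrix d n
    K β = s * K₀ β + s * y β
    K-polyplex : Polyplex K (total K)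
    K-polyplex = (λ β → +-mono-≤ (*-nonNeg 0≤s (proj₁ K₀-polyplex β)) (*-nonNeg 0≤s (0≤y β)))
               , (λ i j → ≤-trans (≤-reflexive (hyperSum-linear K₀ y s s i j))
                            (≤-trans (combination-mono-≤ 0≤s 0≤s (proj₁ (proj₂ K₀-polyplex) i j) (hyperSum≤t i j))
                                     (≤-reflexive (trans (sym (*-distribˡ-+ s 1ℚ t)) (1/pos-inverseˡ 1+t 0<1+t)))))
               , refl
    total≤w : s * w + s * total y ≤ w
    total≤w = subst (_≤ w)
      (trans (total-linear K₀ y s s) (cong (λ W → s * W + s * total y) (proj₂ (proj₂ K₀-polyplex))))
      (proj₂ deficiency K (total K) K-polyplex (Contains-linear K₀ y s s (proj₂ (proj₂ (proj₁ deficiency))) A⊇y))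
    [1+t]*total≡w+T : 1+t * (s * w + s * total y) ≡ w + total y
    [1+t]*total≡w+T = begin
      1+t * (s * w + s * total y)
        ≡⟨ solve 4 (λ 1+t s w T → 1+t :* (s :* w :+ s :* T) := (s :* 1+t) :* (w :+ T)) refl 1+t s w _ ⟩
      (s * 1+t) * (w + total y)   ≡⟨ cong (_* (w + total y)) (1/pos-inverseˡ 1+t 0<1+t) ⟩
      1ℚ * (w + total y)          ≡⟨ *-identityˡ (w + total y) ⟩
      w + total y                 ∎
      where open ≡-Reasoning

  private
    weightConstraint : Constraint (d ℕ.* n)
    weightConstraint = constraint (λ _ → 1ℚ) w

    nonNegConstraint : Fin (d ℕ.* n) → Constraint (d ℕ.* n)
    nonNegConstraint k = constraint (λ k′ → if does (k ≟ k′) then - 1ℚ else 0ℚ) 0ℚ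

    coverTable : Index d n → Table d n
    coverTable β i j = if does (lookup β i ≟ j) then - 1ℚ else 0ℚ

    -- outside supp A this is the vacuous −coverage ≤ 0
    coverConstraint : Index d n → Constraint (d ℕ.* n)
    coverConstraint β = constraint (fromTable (coverTable β)) (if A β then - 1ℚ else 0ℚ)

    system : List (Constraint (d ℕ.* n))
    system = weightConstraint ∷ map nonNegConstraint (allFin (d ℕ.* n)) ++ map coverConstraint (indices d n)

    -- c is t times the weight constraint plus the cover constraints weighted by y, up to
    -- nonnegativity constraints absorbing the slack in the coefficients
    Implied : Constraint (d ℕ.* n) → Set
    Implied c = Σ (Matrix d n) λ y → Σ ℚ λ t → (∀ β → 0ℚ ≤ y β) × Contains A y × 0ℚ ≤ t ×
                (∀ i j → toTable (coeffs c) i j ≤ t - hyperSum y i j) × t * w - total y ≤ bound c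

    Implied-extensional : Extensional Implied
    Implied-extensional (a≗a′ , b≡b′) (y , t , 0≤y , A⊇y , 0≤t , coeffs≤ , bound≥) =
      y , t , 0≤y , A⊇y , 0≤t , (λ i j → subst (_≤ t - hyperSum y i j) (a≗a′ (combine i j)) (coeffs≤ i j)) ,
      subst (_ ≤_) b≡b′ bound≥

    Implied-closed : ConicallyClosed Implied
    Implied-closed s s′ 0≤s 0≤s′ (y , t , 0≤y , A⊇y , 0≤t , coeffs≤ , bound≥)
                              (y′ , t′ , 0≤y′ , A⊇y′ , 0≤t′ , coeffs≤′ , bound≥′) =
      (λ β → s * y β + s′ * y′ β) , s * t + s′ * t′ ,
      (λ β → +-mono-≤ (*-nonNeg 0≤s (0≤y β)) (*-nonNeg 0≤s′ (0≤y′ β))) ,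
      Contains-linear y y′ s s′ A⊇y A⊇y′ , +-mono-≤ (*-nonNeg 0≤s 0≤t) (*-nonNeg 0≤s′ 0≤t′) ,
      (λ i j → ≤-trans (combination-mono-≤ 0≤s 0≤s′ (coeffs≤ i j) (coeffs≤′ i j)) (≤-reflexive (begin
        s * (t - hyperSum y i j) + s′ * (t′ - hyperSum y′ i j)
          ≡⟨ solve 6 (λ s s′ t t′ h h′ → s :* (t :- h) :+ s′ :* (t′ :- h′) := (s :* t :+ s′ :* t′) :- (s :* h :+ s′ :* h′))
                     refl s s′ t t′ _ _ ⟩
        (s * t + s′ * t′) - (s * hyperSum y i j + s′ * hyperSum y′ i j)
          ≡⟨ cong (λ h → (s * t + s′ * t′) - h) (hyperSum-linear y y′ s s′ i j) ⟨
        (s * t + s′ * t′) - hyperSum (λ β → s * y β + s′ * y′ β) i j ∎))) ,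
      ≤-trans (≤-reflexive (begin
        (s * t + s′ * t′) * w - total (λ β → s * y β + s′ * y′ β)
          ≡⟨ cong (λ T → (s * t + s′ * t′) * w - T) (total-linear y y′ s s′) ⟩
        (s * t + s′ * t′) * w - (s * total y + s′ * total y′)
          ≡⟨ solve 7 (λ s s′ t t′ w T T′ → (s :* t :+ s′ :* t′) :* w :- (s :* T :+ s′ :* T′)
                                        := s :* (t :* w :- T) :+ s′ :* (t′ :* w :- T′))
                     refl s s′ t t′ w _ _ ⟩
        s * (t * w - total y) + s′ * (t′ * w - total y′) ∎))
        (combination-mono-≤ 0≤s 0≤s′ bound≥ bound≥′)
      where open ≡-Reasoning

    implied-by-nothing : ∀ {c} → (∀ i j → toTable (coeffs c) i j ≤ 0ℚ) → 0ℚ ≤ bound c → Implied c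
    implied-by-nothing {c} coeffs≤0 0≤bound =
      (λ _ → 0ℚ) , 0ℚ , (λ _ → ≤-refl) , (λ _ 0≢0 → contradiction refl 0≢0) , ≤-refl ,
      (λ i j → subst (toTable (coeffs c) i j ≤_) (cong (λ h → 0ℚ - h) (sym (hyperSum-zero i j))) (coeffs≤0 i j)) ,
      subst (_≤ bound c) (sym (cong₂ _-_ (*-zeroˡ w) (total-zero {d} {n}))) 0≤bound

    system-implied : All Implied system
    system-implied = weight-implied ∷ All.++⁺
      (All.map⁺ {f = nonNegConstraint} (All.universal nonNeg-implied (allFin (d ℕ.* n))))
      (All.map⁺ {f = coverConstraint} (All.universal cover-implied (indices d n)))
      where
      -1or0≤0 : ∀ b → (if b then - 1ℚ else 0ℚ) ≤ 0ℚ
      -1or0≤0 true  = <⇒≤ (negative⁻¹ (- 1ℚ))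
      -1or0≤0 false = ≤-refl
      weight-implied : Implied weightConstraint
      weight-implied = (λ _ → 0ℚ) , 1ℚ , (λ _ → ≤-refl) , (λ _ 0≢0 → contradiction refl 0≢0) , nonNegative⁻¹ 1ℚ ,
        (λ i j → ≤-reflexive (cong (λ h → 1ℚ - h) (sym (hyperSum-zero i j)))) ,
        ≤-reflexive (trans (cong (λ T → 1ℚ * w - T) (total-zero {d} {n}))
                           (trans (+-identityʳ (1ℚ * w)) (*-identityˡ w)))
      nonNeg-implied : ∀ k → Implied (nonNegConstraint k)
      nonNeg-implied k = implied-by-nothing {nonNegConstraint k} (λ i j → -1or0≤0 (does (k ≟ combine i j))) ≤-refl
      cover-implied : ∀ β → Implied (coverConstraint β)
      cover-implied β = implied (A β) refl
        where
        implied : ∀ b → A β ≡ b → Implied (coverConstraint β)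
        implied false Aβ = implied-by-nothing {coverConstraint β}
          (λ i j → subst (_≤ 0ℚ) (sym (fromTable-combine (coverTable β) i j)) (-1or0≤0 _))
          (≤-reflexive (cong (if_then - 1ℚ else 0ℚ) (sym Aβ)))
        implied true Aβ = unit β , 0ℚ , unit-nonNeg , unit-contained , ≤-refl ,
          (λ i j → subst₂ _≤_ (sym (fromTable-combine (coverTable β) i j))
                              (cong (λ h → 0ℚ - h) (sym (hyperSum-unit β i j)))
                              (-1≤-1 (does (lookup β i ≟ j)))) ,
          ≤-reflexive (trans (cong₂ _-_ (*-zeroˡ w) (total-unit β)) (cong (if_then - 1ℚ else 0ℚ) (sym Aβ)))
          where
          unit-nonNeg : ∀ α → 0ℚ ≤ unit β α
          unit-nonNeg α with does (≡-dec _≟_ β α)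
          ... | true  = nonNegative⁻¹ 1ℚ
          ... | false = ≤-refl
          unit-contained : Contains A (unit β)
          unit-contained α ≢0 with ≡-dec _≟_ β α
          ... | yes refl = Aβ
          ... | no  _    = contradiction refl ≢0
          -1≤-1 : ∀ b → (if b then - 1ℚ else 0ℚ) ≤ 0ℚ - (if b then 1ℚ else 0ℚ)
          -1≤-1 true  = ≤-refl
          -1≤-1 false = ≤-refl

    no-refutation : ¬ Refutation Implied
    no-refutation (c , (y , t , 0≤y , A⊇y , 0≤t , coeffs≤ , bound≥) , c≗0 , bound<0) =
      <-irrefl refl (≤-<-trans (p≤q⇒0≤q-p (total≤scaled-maxWeight y t 0≤y A⊇y 0≤t hyperSum≤t))
                               (≤-<-trans bound≥ bound<0))
      where
      hyperSum≤t : ∀ i j → hyperSum y i j ≤ t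
      hyperSum≤t i j = 0≤q-p⇒p≤q (subst (_≤ t - hyperSum y i j) (c≗0 (combine i j)) (coeffs≤ i j))

    solution-cover : ∀ x → All (Satisfies x) system →
                     HyperplaneCover A (toTable {d} {n} x) × weight (toTable {d} {n} x) ≤ w
    solution-cover x (weight-sat ∷ sat) = ((λ i j → 0≤x (combine i j)) , covered) , subst (_≤ w) ·1≡weight weight-sat
      where
      0≤x : ∀ k → 0ℚ ≤ x k
      0≤x k = ≤-byDifference (p≤q⇒0≤q-p (subst (_≤ 0ℚ) ·≡-x (All.lookup nonNeg-sat (∈-allFin k))))
                (solve 1 (λ v → v :- con 0ℚ := con 0ℚ :- (:- con 1ℚ :* v)) refl (x k))
        where
        nonNeg-sat : All (Satisfies x ∘ nonNegConstraint) (allFin (d ℕ.* n))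
        nonNeg-sat = All.map⁻ (All.++⁻ˡ (map nonNegConstraint (allFin (d ℕ.* n))) sat)
        ·≡-x : coeffs (nonNegConstraint k) · x ≡ - 1ℚ * x k
        ·≡-x = trans (sum-cong (allFin (d ℕ.* n)) (λ k′ → if-*ˡ (does (k ≟ k′)) (- 1ℚ) (x k′)))
                     (sumFin-δ (d ℕ.* n) k (λ k′ → - 1ℚ * x k′))
      covered : ∀ β → A β ≡ true → 1ℚ ≤ coverage (toTable {d} {n} x) β
      covered β Aβ =
        ≤-byDifference
          (p≤q⇒0≤q-p (subst₂ _≤_ ·≡-coverage (cong (if_then - 1ℚ else 0ℚ) Aβ) (All.lookup cover-sat (∈-indices β))))
          (solve 1 (λ c → c :- con 1ℚ := :- con 1ℚ :- (:- con 1ℚ :* c)) refl (coverage (toTable {d} {n} x) β))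
        where
        cover-sat : All (Satisfies x ∘ coverConstraint) (indices d n)
        cover-sat = All.map⁻ (All.++⁻ʳ (map nonNegConstraint (allFin (d ℕ.* n))) sat)
        ·≡-coverage : fromTable (coverTable β) · x ≡ - 1ℚ * coverage (toTable {d} {n} x) β
        ·≡-coverage = trans (fromTable-· (coverTable β) x) (trans
          (sum-cong (allFin d) λ i →
            trans (sum-cong (allFin n) (λ j → if-*ˡ (does (lookup β i ≟ j)) (- 1ℚ) (toTable {d} {n} x i j)))
                  (sumFin-δ n (lookup β i) (λ j → - 1ℚ * toTable {d} {n} x i j)))
          (sum-distribˡ-* (allFin d) (- 1ℚ) _))
      ·1≡weight : (λ _ → 1ℚ) · x ≡ weight (toTable {d} {n} x)
      ·1≡weight = trans (sumFin-combine d n (λ k → 1ℚ * x k))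
        (sum-cong (allFin d) λ i → sum-cong (allFin n) λ j → *-identityˡ (toTable {d} {n} x i j))

  optimalCover-weight≤n-δ : ∀ {Λ} → OptimalCover A Λ → weight Λ ≤ ℕtoℚ n - δ
  optimalCover-weight≤n-δ (_ , optimal)
    with fourier-motzkin (d ℕ.* n) (λ {c c′} → Implied-extensional {c} {c′}) (λ {c c′} → Implied-closed {c} {c′})
                         system system-implied
  ... | inj₁ (x , sat)  = let cover , weight≤n-δ = solution-cover x sat in
                          ≤-trans (optimal (toTable x) cover) weight≤n-δ
  ... | inj₂ refutation = contradiction refutation no-refutation

-- Lowering one entry of an optimal cover

module _ {d n : ℕ} where

  pairing : (P : Matrix d n) (Λ : Table d n) →
            sumℚ (map (λ β → P β * coverage Λ β) (indices d n)) ≡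
            sumFin d (λ i → sumFin n (λ j → Λ i j * hyperSum P i j))
  pairing P Λ = begin
    sumℚ (map (λ β → P β * coverage Λ β) L)
      ≡⟨ sum-cong L (λ β → sum-distribˡ-* (allFin d) (P β) _) ⟨
    sumℚ (map (λ β → sumFin d (λ i → P β * Λ i (lookup β i))) L)
      ≡⟨ sum-comm L (allFin d) (λ β i → P β * Λ i (lookup β i)) ⟩
    sumFin d (λ i → sumℚ (map (λ β → P β * Λ i (lookup β i)) L))
      ≡⟨ sum-cong (allFin d) row ⟩
    sumFin d (λ i → sumFin n (λ j → Λ i j * hyperSum P i j)) ∎
    where
    open ≡-Reasoning
    L : List (Index d n)
    L = indices d n
    if-*ʳ : ∀ (b : Bool) p q → (if b then p * q else 0ℚ) ≡ q * (if b then p else 0ℚ)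
    if-*ʳ true  p q = *-comm p q
    if-*ʳ false p q = sym (*-zeroʳ q)
    row : ∀ i → sumℚ (map (λ β → P β * Λ i (lookup β i)) L) ≡ sumFin n (λ j → Λ i j * hyperSum P i j)
    row i = begin
      sumℚ (map (λ β → P β * Λ i (lookup β i)) L)
        ≡⟨ sum-cong L (λ β → sumFin-δ n (lookup β i) (λ j → P β * Λ i j)) ⟨
      sumℚ (map (λ β → sumFin n (λ j → if does (lookup β i ≟ j) then P β * Λ i j else 0ℚ)) L)
        ≡⟨ sum-comm L (allFin n) (λ β j → if does (lookup β i ≟ j) then P β * Λ i j else 0ℚ) ⟩
      sumFin n (λ j → sumℚ (map (λ β → if does (lookup β i ≟ j) then P β * Λ i j else 0ℚ) L))
        ≡⟨ sum-cong (allFin n) (λ j → trans (sum-cong L (λ β → if-*ʳ (does (lookup β i ≟ j)) (P β) (Λ i j)))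
                                            (sum-distribˡ-* L (Λ i j) _)) ⟩
      sumFin n (λ j → Λ i j * hyperSum P i j) ∎

  pairing≤weight : (P : Matrix d n) (Λ : Table d n) → (∀ i j → 0ℚ ≤ Λ i j) → (∀ i j → hyperSum P i j ≤ 1ℚ) →
                   sumℚ (map (λ β → P β * coverage Λ β) (indices d n)) ≤ weight Λ
  pairing≤weight P Λ 0≤Λ hyperSum≤1 = subst (_≤ weight Λ) (sym (pairing P Λ))
    (sum-mono-≤ (allFin d) λ i → sum-mono-≤ (allFin n) λ j →
      subst (Λ i j * hyperSum P i j ≤_) (*-identityʳ (Λ i j))
            (*-monoˡ-≤-nonNeg (Λ i j) {{nonNegative (0≤Λ i j)}} (hyperSum≤1 i j)))

  entry≤hyperSum : (K : Matrix d n) → (∀ β → 0ℚ ≤ K β) → ∀ α i → K α ≤ hyperSum K i (lookup α i)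
  entry≤hyperSum K 0≤K α i =
    subst (_≤ hyperSum K i (lookup α i)) (cong (if_then K α else 0ℚ) (dec-true (lookup α i ≟ lookup α i) refl))
          (term≤sum-indices d n α (λ β → if does (lookup β i ≟ lookup α i) then K β else 0ℚ) (λ β _ → 0≤masked β))
    where
    0≤masked : ∀ β → 0ℚ ≤ (if does (lookup β i ≟ lookup α i) then K β else 0ℚ)
    0≤masked β with does (lookup β i ≟ lookup α i)
    ... | true  = 0≤K β
    ... | false = ≤-refl

module _ {d n : ℕ} {A : Matrix01 d n} {δ : ℚ} {Λ : Table d n}
         (cover : HyperplaneCover A Λ) (weight≤n-δ : weight Λ ≤ ℕtoℚ n - δ) where

  coverage≤1-deficiency : Fin d → ∀ α → ContainsPolydiagonal (setOne A α) → coverage Λ α ≤ 1ℚ →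
                          δ ≤ 1ℚ - coverage Λ α
  coverage≤1-deficiency i α (P , (0≤P , hyperSum≤1 , total≡n) , A⊇P) cov≤1 =
    ≤-trans δ≤Pα*[1-cov]
      (subst (P α * (1ℚ - c) ≤_) (*-identityˡ (1ℚ - c))
             (*-monoʳ-≤-nonNeg (1ℚ - c) {{nonNegative (p≤q⇒0≤q-p cov≤1)}} Pα≤1))
    where
    c : ℚ
    c = coverage Λ α
    L : List (Index d n)
    L = indices d n
    excess : Index d n → ℚ
    excess β = P β * (coverage Λ β - 1ℚ)
    0≤excess : ∀ β → β ≢ α → 0ℚ ≤ excess β
    0≤excess β β≢α with P β ≟ℚ 0ℚ
    ... | yes Pβ≡0 = ≤-reflexive (sym (trans (cong (_* (coverage Λ β - 1ℚ)) Pβ≡0) (*-zeroˡ (coverage Λ β - 1ℚ))))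
    ... | no  Pβ≢0 = *-nonNeg (0≤P β) (p≤q⇒0≤q-p (proj₂ cover β Aβ))
      where
      Aβ : A β ≡ true
      Aβ = trans (sym (∨-identityʳ (A β)))
                 (trans (cong (A β ∨_) (sym (dec-false (≡-dec _≟_ β α) β≢α))) (A⊇P β Pβ≢0))
    n+excess≤n-δ : ℕtoℚ n + excess α ≤ ℕtoℚ n - δ
    n+excess≤n-δ = begin
      ℕtoℚ n + excess α
        ≤⟨ +-mono-≤ (≤-reflexive (sym total≡n)) (term≤sum-indices d n α excess 0≤excess) ⟩
      total P + sumℚ (map excess L)
        ≡⟨ sum-distrib-+ L P excess ⟨
      sumℚ (map (λ β → P β + excess β) L)
        ≡⟨ sum-cong L (λ β → solve 2 (λ p c → p :+ p :* (c :- con 1ℚ) := p :* c) refl (P β) (coverage Λ β)) ⟩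
      sumℚ (map (λ β → P β * coverage Λ β) L)
        ≤⟨ pairing≤weight P Λ (proj₁ cover) hyperSum≤1 ⟩
      weight Λ
        ≤⟨ weight≤n-δ ⟩
      ℕtoℚ n - δ ∎
      where open ≤-Reasoning
    δ≤Pα*[1-cov] : δ ≤ P α * (1ℚ - c)
    δ≤Pα*[1-cov] = ≤-byDifference (p≤q⇒0≤q-p n+excess≤n-δ)
      (solve 4 (λ p c δ m → p :* (con 1ℚ :- c) :- δ := (m :- δ) :- (m :+ p :* (c :- con 1ℚ))) refl (P α) c δ (ℕtoℚ n))
    Pα≤1 : P α ≤ 1ℚ
    Pα≤1 = ≤-trans (entry≤hyperSum P 0≤P α i) (hyperSum≤1 i (lookup α i))

setEntry : ∀ {d n} → Table d n → Fin d → Fin n → ℚ → Table d n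
setEntry Λ i j v = updateAt Λ i (λ row → updateAt row j (λ _ → v))

module _ {d n : ℕ} (Λ : Table d n) (i : Fin d) (j : Fin n) (v : ℚ) where

  private
    Λ′ : Table d n
    Λ′ = setEntry Λ i j v

  update-at : Λ′ i j ≡ v
  update-at = trans (cong (λ row → row j) (updateAt-updates i Λ)) (updateAt-updates j (Λ i))

  update-at-difference : Λ i j ≡ Λ′ i j + (Λ i j - v)
  update-at-difference = trans (solve 2 (λ a v → a := v :+ (a :- v)) refl (Λ i j) v) (cong (_+ (Λ i j - v)) (sym update-at))

  update-otherRow : ∀ {i′} → i′ ≢ i → Λ′ i′ ≡ Λ i′
  update-otherRow i′≢i = updateAt-minimal _ i Λ i′≢i

  update-otherColumn : ∀ {j′} → j′ ≢ j → Λ′ i j′ ≡ Λ i j′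
  update-otherColumn j′≢j = trans (cong (λ row → row _) (updateAt-updates i Λ)) (updateAt-minimal _ j (Λ i) j′≢j)

  update-nonNeg : (∀ i j → 0ℚ ≤ Λ i j) → 0ℚ ≤ v → ∀ i′ j′ → 0ℚ ≤ Λ′ i′ j′
  update-nonNeg 0≤Λ 0≤v i′ j′ with i′ ≟ i | j′ ≟ j
  ... | yes refl | yes refl = subst (0ℚ ≤_) (sym update-at) 0≤v
  ... | yes refl | no j′≢j  = subst (0ℚ ≤_) (sym (update-otherColumn j′≢j)) (0≤Λ i j′)
  ... | no i′≢i  | _        = subst (0ℚ ≤_) (sym (cong (λ row → row j′) (update-otherRow i′≢i))) (0≤Λ i′ j′)

  weight-update : weight Λ ≡ weight Λ′ + (Λ i j - v)
  weight-update =
    sumFin-except d i (sumFin-except n j update-at-difference (λ j′ j′≢j → sym (update-otherColumn j′≢j)))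
                      (λ i′ i′≢i → cong (sumFin n) (sym (update-otherRow i′≢i)))

  coverage-update-elsewhere : ∀ β → lookup β i ≢ j → coverage Λ′ β ≡ coverage Λ β
  coverage-update-elsewhere β βi≢j = sum-cong (allFin d) unchanged
    where
    unchanged : ∀ i′ → Λ′ i′ (lookup β i′) ≡ Λ i′ (lookup β i′)
    unchanged i′ with i′ ≟ i
    ... | yes refl = update-otherColumn βi≢j
    ... | no i′≢i  = cong (λ row → row (lookup β i′)) (update-otherRow i′≢i)

  coverage-update-through : ∀ β → lookup β i ≡ j → coverage Λ β ≡ coverage Λ′ β + (Λ i j - v)
  coverage-update-through β refl = sumFin-except d i update-at-difference
    (λ i′ i′≢i → cong (λ row → row (lookup β i′)) (sym (update-otherRow i′≢i)))

coverage-lowered : ∀ {d n} (Λ : Table d n) i j l β → lookup β i ≡ j →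
                   coverage (setEntry Λ i j (Λ i l)) β ≡ coverage Λ (β [ i ]≔ l)
coverage-lowered {d} Λ i j l β refl = sum-cong (allFin d) shifted
  where
  shifted : ∀ i′ → setEntry Λ i (lookup β i) (Λ i l) i′ (lookup β i′) ≡ Λ i′ (lookup (β [ i ]≔ l) i′)
  shifted i′ with i′ ≟ i
  ... | yes refl = trans (update-at Λ i (lookup β i) (Λ i l)) (cong (Λ i) (sym (lookup∘update i β l)))
  ... | no i′≢i  = trans (cong (λ row → row (lookup β i′)) (update-otherRow Λ i (lookup β i) (Λ i l) i′≢i))
                         (cong (Λ i′) (sym (lookup∘update′ i′≢i β l)))

module Lowering {d n : ℕ} {A : Matrix01 d n} {δ : ℚ} {Λ : Table d n}
                (saturated : ∀ α → A α ≡ false → ContainsPolydiagonal (setOne A α))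
                (cover : HyperplaneCover A Λ) (weight≤n-δ : weight Λ ≤ ℕtoℚ n - δ)
                (i : Fin d) (j l : Fin n) where

  ε : ℚ
  ε = Λ i j - Λ i l

  Λ′ : Table d n
  Λ′ = setEntry Λ i j (Λ i l)

  lowered-cover : ε < δ → HyperplaneCover A Λ′
  lowered-cover ε<δ = update-nonNeg Λ i j (Λ i l) (proj₁ cover) (proj₁ cover i l) , covered
    where
    covered : ∀ β → A β ≡ true → 1ℚ ≤ coverage Λ′ β
    covered β Aβ with lookup β i ≟ j
    ... | no  βi≢j = subst (1ℚ ≤_) (sym (coverage-update-elsewhere Λ i j (Λ i l) β βi≢j)) (proj₂ cover β Aβ)
    ... | yes βi≡j = decidable-stable (1ℚ ≤? coverage Λ′ β) (λ 1≰cov′ → neighbour-uncovered (≰⇒> 1≰cov′))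
      where
      α : Index d n
      α = β [ i ]≔ l
      cov′≡covα : coverage Λ′ β ≡ coverage Λ α
      cov′≡covα = coverage-lowered Λ i j l β βi≡j
      1-covα≤ε : 1ℚ - coverage Λ α ≤ ε
      1-covα≤ε = ≤-byDifference
        (p≤q⇒0≤q-p (subst (1ℚ ≤_) (coverage-update-through Λ i j (Λ i l) β βi≡j) (proj₂ cover β Aβ)))
        (trans (cong (λ c → ε - (1ℚ - c)) (sym cov′≡covα))
               (solve 2 (λ e c → e :- (con 1ℚ :- c) := (c :+ e) :- con 1ℚ) refl ε (coverage Λ′ β)))
      neighbour-uncovered : coverage Λ′ β < 1ℚ → ⊥
      neighbour-uncovered cov′<1 with A α in Aα
      ... | true  = <-irrefl refl (<-≤-trans cov′<1 (subst (1ℚ ≤_) (sym cov′≡covα) (proj₂ cover α Aα)))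
      ... | false = <-irrefl refl (≤-<-trans (≤-trans δ≤1-covα 1-covα≤ε) ε<δ)
        where
        δ≤1-covα : δ ≤ 1ℚ - coverage Λ α
        δ≤1-covα = coverage≤1-deficiency cover weight≤n-δ i α (saturated α Aα)
                                         (<⇒≤ (subst (_< 1ℚ) cov′≡covα cov′<1))

  deficiency≤gap : (∀ Λ″ → HyperplaneCover A Λ″ → weight Λ ≤ weight Λ″) → Λ i l < Λ i j → δ ≤ ε
  deficiency≤gap optimal Λil<Λij = decidable-stable (δ ≤? ε) λ δ≰ε →
    <-irrefl refl (<-≤-trans weight′<weight (optimal Λ′ (lowered-cover (≰⇒> δ≰ε))))
    where
    weight′<weight : weight Λ′ < weight Λ
    weight′<weight = subst₂ _<_ (+-identityʳ (weight Λ′)) (sym (weight-update Λ i j (Λ i l)))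
                       (+-monoʳ-< (weight Λ′) (p<q⇒0<q-p Λil<Λij))

row-gap≥deficiency : ∀ {d n} {A : Matrix01 d n} {δ : ℚ} {Λ : Table d n} →
                     (∀ α → A α ≡ false → ContainsPolydiagonal (setOne A α)) →
                     IsDeficiency A δ → OptimalCover A Λ →
                     ∀ i j l → Λ i l < Λ i j → δ ≤ Λ i j - Λ i l
row-gap≥deficiency saturated deficiency optimal@(cover , minimal) i j l =
  Lowering.deficiency≤gap saturated cover (optimalCover-weight≤n-δ deficiency optimal) i j l minimal

≤∣p-q∣ : p ≢ q → (q < p → r ≤ p - q) → (p < q → r ≤ q - p) → r ≤ ∣ p - q ∣
≤∣p-q∣ {p} {q} {r} p≢q q<p⇒ p<q⇒ with <-cmp p q
... | tri< p<q _ _ =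
  subst (r ≤_) (trans (sym (0≤p⇒∣p∣≡p (<⇒≤ (p<q⇒0<q-p p<q)))) ∣q-p∣≡∣p-q∣) (p<q⇒ p<q)
  where
  ∣q-p∣≡∣p-q∣ : ∣ q - p ∣ ≡ ∣ p - q ∣
  ∣q-p∣≡∣p-q∣ = trans (sym (∣-p∣≡∣p∣ (q - p))) (cong ∣_∣ (solve 2 (λ p q → :- (q :- p) := p :- q) refl p q))
... | tri≈ _ p≡q _ = contradiction p≡q p≢q
... | tri> _ _ q<p = subst (r ≤_) (sym (0≤p⇒∣p∣≡p (<⇒≤ (p<q⇒0<q-p q<p)))) (q<p⇒ q<p)

proposition5p5 : (d n : ℕ) (A : Matrix01 d n) (δ : ℚ) (Λ : Table d n) →
    Extremal A → IsDeficiency A δ → OptimalCover A Λ →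
    (i : Fin d) (j l : Fin n) → Λ i j ≢ Λ i l → δ ≤ ∣ Λ i j - Λ i l ∣
proposition5p5 d n A δ Λ (_ , saturated) deficiency optimal i j l Λij≢Λil =
  ≤∣p-q∣ Λij≢Λil (gap j l) (gap l j)
  where
  gap : ∀ j l → Λ i l < Λ i j → δ ≤ Λ i j - Λ i l
  gap = row-gap≥deficiency saturated deficiency optimal i
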